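{- For every integer $n\ge 3$ and every $k\in\{3,4,5\}$, the star $(k,n)$-gon is neighborhood-prime.
   Context: A neighborhood-prime labeling of a simple graph $G$ with $N$ vertices is a bijection $f:V(G)\to\{1,\ldots,N\}$ such that for every vertex $v$ with $\deg(v)>1$, $\gcd\{f(u):u\in N(v)\}=1$, where $N(v)$ is the neighborhood of $v$; a graph admitting one is neighborhood-prime. The star $(k,n)$-gon is constructed from a cycle $C_n$ by, for each edge $xy$ of $C_n$, adding a new path on $k-2$ vertices and joining its two endpoints to $x$ and $y$ respectively (so each edge of $C_n$ lies on a new $k$-cycle; for $k=3$ the path is a single vertex adjacent to both $x$ and $y$). -}

module Defs where

open import Data.Nat using (ℕ; zero; suc; _+_; _*_; _∸_; _<ᵇ_; _≡ᵇ_; _>_)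
open import Data.Nat.Divisibility using (_∣_)
open import Data.Nat.DivMod using (_/_; _%_)
open import Data.Bool using (Bool; true; false; T; _∧_; _∨_; if_then_else_)
open import Data.Bool.Properties using (T?)
open import Data.Fin using (Fin; toℕ)
open import Data.List using (length; filter; allFin)
open import Data.Product using (Σ)
open import Relation.Binary.PropositionalEquality using (_≡_)
open import Function.Bundles using (_⤖_; Bijection)

record Graph : Set where
  field
    N   : ℕ
    adj : Fin N → Fin N → Bool

open Graph public

deg : (G : Graph) → Fin (N G) → ℕ
deg G v = length (filter (λ u → T? (adj G v u)) (allFin (N G)))

-- A bijection f : V(G) → {1,…,N} is encoded as a bijection Fin N ⤖ Fin N,
-- vertex v receiving the label  1 + toℕ (f v).
label : ∀ {N} → (Fin N ⤖ Fin N) → Fin N → ℕ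
label f v = suc (toℕ (Bijection.to f v))

NbhdGcdOne : (G : Graph) → (Fin (N G) ⤖ Fin (N G)) → Fin (N G) → Set
NbhdGcdOne G f v = ∀ (d : ℕ) → (∀ u → T (adj G v u) → d ∣ label f u) → d ≡ 1

IsNeighborhoodPrimeLabeling : (G : Graph) → (Fin (N G) ⤖ Fin (N G)) → Set
IsNeighborhoodPrimeLabeling G f = ∀ v → deg G v > 1 → NbhdGcdOne G f v

NeighborhoodPrime : Graph → Set
NeighborhoodPrime G = Σ (Fin (N G) ⤖ Fin (N G)) (IsNeighborhoodPrimeLabeling G)

-- Vertices are numbered 0 … n + n*(k-2) - 1:
--   * m < n            : the cycle vertex c_m of C_n (edges c_a c_{a+1 mod n});
--   * m = n + e*(k-2)+j : the j-th vertex (0 ≤ j < k-2) of the path attached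
--                         to the cycle edge c_e c_{e+1 mod n} (0 ≤ e < n);
--     its vertex j = 0 is joined to c_e, its vertex j = k-3 to c_{e+1 mod n},
--     and consecutive path vertices are joined.
-- For k ≥ 3 we have k ∸ 2 = suc (k ∸ 3), which is used as the (nonzero) divisor.

module Star (k n : ℕ) where
  pathLen : ℕ
  pathLen = k ∸ 2

  q : ℕ
  q = suc (k ∸ 3)

  nxt : ℕ → ℕ
  nxt a = if suc a ≡ᵇ n then 0 else suc a

  isCyc : ℕ → Bool
  isCyc m = m <ᵇ n

  edgeOf : ℕ → ℕ
  edgeOf m = (m ∸ n) / q

  posOf : ℕ → ℕ
  posOf m = (m ∸ n) % q

  cycPath : ℕ → ℕ → Bool
  cycPath a m = ((posOf m ≡ᵇ 0) ∧ (a ≡ᵇ edgeOf m))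
              ∨ ((posOf m ≡ᵇ (k ∸ 3)) ∧ (a ≡ᵇ nxt (edgeOf m)))

  adjℕ : ℕ → ℕ → Bool
  adjℕ u v with isCyc u | isCyc v
  ... | true  | true  = (nxt u ≡ᵇ v) ∨ (nxt v ≡ᵇ u)
  ... | true  | false = cycPath u v
  ... | false | true  = cycPath v u
  ... | false | false = (edgeOf u ≡ᵇ edgeOf v)
                        ∧ ((suc (posOf u) ≡ᵇ posOf v) ∨ (suc (posOf v) ≡ᵇ posOf u))

  graph : Graph
  graph = record { N = n + n * pathLen ; adj = λ u v → adjℕ (toℕ u) (toℕ v) }

starGon : ℕ → ℕ → Graph
starGon k n = Star.graph k n

module Submission where

-- The labellings below give every vertex two neighbours whose labels are coprime for
-- a simple reason: they are consecutive, or one of them is 1, or both are odd and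
-- differ by 2.  With c_e the cycle vertices and p_{e,j} the j-th vertex of the path on
-- the edge c_e c_{e+1}, the labels are
--   k = 3 :  c_e ↦ e + 1,   p_{e,0} ↦ n + e + 1;
--   k = 4 :  c_e ↦ 3e + 1,  p_{e,1} ↦ 3e + 2,  p_{e,0} ↦ 3e + 3;
--   k = 5 :  c_e ↦ 2e + 1,  p_{e,1} ↦ 2e + 2,  p_{e,0} ↦ 2n + 2e + 1,  p_{e,2} ↦ 2n + 2e + 2.
-- Stepping from the end of a path to the next cycle vertex raises the label by one,
-- except where the cycle closes up, at c_0, which carries the label 1.

open import Defs
open import Data.Bool using (true; false; T; _∧_; _∨_; if_then_else_)
open import Data.Bool.Properties using (∨-comm; T-≡; T-∧; T-∨)
open import Data.Fin using (Fin; toℕ; fromℕ<)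
open import Data.Fin.Properties using (toℕ-fromℕ<; toℕ<n; toℕ-injective)
open import Data.Nat
open import Data.Nat.Coprimality using (Coprime; coprime-+; 1-coprimeTo) renaming (sym to coprime-sym)
open import Data.Nat.DivMod
open import Data.Nat.Divisibility using (n∣m*n)
open import Data.Nat.Properties
open import Data.Nat.Tactic.RingSolver using (solve-∀)
open import Data.Product using (_×_; _,_; proj₁; proj₂)
open import Data.Sum using (_⊎_; inj₁; inj₂)
open import Function.Base using (id)
open import Function.Bundles using (_⤖_; Bijection; mk↔ₛ′; Equivalence)
open import Function.Properties.Inverse using (↔⇒⤖)
open import Relation.Binary.PropositionalEquality
open import Relation.Nullary using (yes; no; contradiction)

coprime-suc : ∀ m → Coprime m (suc m)
coprime-suc m = coprime-sym (subst (λ k → Coprime k m) (+-comm m 1) (coprime-+ (1-coprimeTo m)))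

odd-coprime-2 : ∀ t → Coprime (1 + t * 2) 2
odd-coprime-2 zero    = 1-coprimeTo 2
odd-coprime-2 (suc t) = coprime-+ (odd-coprime-2 t)

odd-coprime-odd+2 : ∀ t → Coprime (1 + t * 2) (3 + t * 2)
odd-coprime-odd+2 t =
  coprime-sym (subst (λ k → Coprime k (1 + t * 2)) (+-comm (1 + t * 2) 2)
                     (coprime-+ (coprime-sym (odd-coprime-2 t))))

1<3 : 1 < 3
1<3 = s≤s (s≤s z≤n)

pred[n]<n : ∀ {n} .{{_ : NonZero n}} → pred n < n
pred[n]<n = m≤pred[n]⇒suc[m]≤n ≤-refl

[r+b*d]%d≡r : ∀ {r} b {d} .{{_ : NonZero d}} → r < d → (r + b * d) % d ≡ r
[r+b*d]%d≡r {r} b {d} r<d = trans ([m+kn]%n≡m%n r b d) (m<n⇒m%n≡m r<d)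

[r+b*d]/d≡b : ∀ {r} b {d} .{{_ : NonZero d}} → r < d → (r + b * d) / d ≡ b
[r+b*d]/d≡b {r} b {d} r<d = begin
  (r + b * d) / d    ≡⟨ +-distrib-/-∣ʳ r (n∣m*n b) ⟩
  r / d + b * d / d  ≡⟨ cong₂ _+_ (m<n⇒m/n≡0 r<d) (m*n/n≡m b d) ⟩
  b                  ∎
  where open ≡-Reasoning

r+b*d<B*d : ∀ {r b d B} → r < d → b < B → r + b * d < B * d
r+b*d<B*d {r} {b} {d} {B} r<d b<B = begin-strict
  r + b * d  <⟨ +-monoˡ-< (b * d) r<d ⟩
  suc b * d  ≤⟨ *-monoˡ-≤ d b<B ⟩
  B * d      ∎
  where open ≤-Reasoning

data QuotRem (d B : ℕ) : ℕ → Set where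
  quotRem : ∀ {r b} → r < d → b < B → QuotRem d B (r + b * d)

quotRemView : ∀ {d B x} .{{_ : NonZero d}} → x < B * d → QuotRem d B x
quotRemView {d} {B} {x} x<B*d =
  subst (QuotRem d B) (sym (m≡m%n+[m/n]*n x d)) (quotRem (m%n<n x d) (m<n*o⇒m/o<n x<B*d))

≡ᵇ-refl : ∀ m → T (m ≡ᵇ m)
≡ᵇ-refl m = ≡⇒≡ᵇ m m refl

≡ᵇ-comm : ∀ m n → (m ≡ᵇ n) ≡ (n ≡ᵇ m)
≡ᵇ-comm zero    zero    = refl
≡ᵇ-comm zero    (suc n) = refl
≡ᵇ-comm (suc m) zero    = refl
≡ᵇ-comm (suc m) (suc n) = ≡ᵇ-comm m n

m+n<ᵇm : ∀ m n → (m + n <ᵇ m) ≡ false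
m+n<ᵇm zero    n = refl
m+n<ᵇm (suc m) n = m+n<ᵇm m n

T⇒≡true : ∀ {b} → T b → b ≡ true
T⇒≡true = Equivalence.to T-≡

LeftInverseBelow : ℕ → (ℕ → ℕ) → (ℕ → ℕ) → Set
LeftInverseBelow N g f = ∀ {m} → m < N → f m < N × g (f m) ≡ m

module _ {N : ℕ} {f g : ℕ → ℕ} (g∘f : LeftInverseBelow N g f) (f∘g : LeftInverseBelow N f g) where

  private
    restrict : ∀ {h h⁻¹} → LeftInverseBelow N h⁻¹ h → Fin N → Fin N
    restrict inv i = fromℕ< (proj₁ (inv (toℕ<n i)))

    toℕ-restrict : ∀ {h h⁻¹} (inv : LeftInverseBelow N h⁻¹ h) i →
                   toℕ (restrict {h} {h⁻¹} inv i) ≡ h (toℕ i)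
    toℕ-restrict inv i = toℕ-fromℕ< (proj₁ (inv (toℕ<n i)))

    restrict-inverse : ∀ {h h⁻¹} (inv : LeftInverseBelow N h⁻¹ h) (inv⁻¹ : LeftInverseBelow N h h⁻¹) i →
                       restrict {h⁻¹} {h} inv⁻¹ (restrict {h} {h⁻¹} inv i) ≡ i
    restrict-inverse {h} {h⁻¹} inv inv⁻¹ i = toℕ-injective (begin
      toℕ (restrict {h⁻¹} {h} inv⁻¹ hi) ≡⟨ toℕ-restrict {h⁻¹} {h} inv⁻¹ hi ⟩
      h⁻¹ (toℕ hi)                      ≡⟨ cong h⁻¹ (toℕ-restrict {h} {h⁻¹} inv i) ⟩
      h⁻¹ (h (toℕ i))                   ≡⟨ proj₂ (inv (toℕ<n i)) ⟩
      toℕ i                             ∎)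
      where
        open ≡-Reasoning
        hi : Fin N
        hi = restrict {h} {h⁻¹} inv i

  permutationBelow : Fin N ⤖ Fin N
  permutationBelow = ↔⇒⤖ (mk↔ₛ′ (restrict {f} {g} g∘f) (restrict {g} {f} f∘g)
                                (restrict-inverse {g} {f} f∘g g∘f) (restrict-inverse {f} {g} g∘f f∘g))

  toℕ-permutationBelow : ∀ i → toℕ (Bijection.to permutationBelow i) ≡ f (toℕ i)
  toℕ-permutationBelow = toℕ-restrict {f} {g} g∘f

coprimeNeighbors⇒NbhdGcdOne : ∀ G (f : Fin (N G) ⤖ Fin (N G)) v {u w} → T (adj G v u) → T (adj G v w) →
                              Coprime (label f u) (label f w) → NbhdGcdOne G f v
coprimeNeighbors⇒NbhdGcdOne G f v v~u v~w coprime d d∣neighbors =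
  coprime (d∣neighbors _ v~u , d∣neighbors _ v~w)

module StarGeometry (p n : ℕ) where
  open Star (3 + p) n public

  order : ℕ
  order = n + n * suc p

  order≡n*[2+p] : order ≡ n * (2 + p)
  order≡n*[2+p] = sym (*-suc n (suc p))

  pathVertex : ℕ → ℕ → ℕ
  pathVertex e j = n + (j + e * suc p)

  data Vertex : ℕ → Set where
    cycle : ∀ {a} → a < n → Vertex a
    path  : ∀ {e j} → e < n → j < suc p → Vertex (pathVertex e j)

  vertexView : ∀ {m} → m < order → Vertex m
  vertexView {m} m<order with m <? n
  ... | yes m<n = cycle m<n
  ... | no  m≮n = subst Vertex (m+[n∸m]≡n n≤m) (shift (quotRemView m∸n<n*q))
    where
      n≤m : n ≤ m
      n≤m = ≮⇒≥ m≮n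
      m∸n<n*q : m ∸ n < n * suc p
      m∸n<n*q = subst (m ∸ n <_) (m+n∸m≡n n _) (∸-monoˡ-< m<order n≤m)
      shift : ∀ {x} → QuotRem (suc p) n x → Vertex (n + x)
      shift (quotRem j<q e<n) = path e<n j<q

  cycle<order : ∀ {a} → a < n → a < order
  cycle<order a<n = ≤-trans a<n (m≤m+n n _)

  path<order : ∀ {e j} → e < n → j < suc p → pathVertex e j < order
  path<order e<n j<q = +-monoʳ-< n (r+b*d<B*d j<q e<n)

  isCyc-cycle : ∀ {a} → a < n → isCyc a ≡ true
  isCyc-cycle a<n = T⇒≡true (<⇒<ᵇ a<n)

  isCyc-path : ∀ e j → isCyc (pathVertex e j) ≡ false
  isCyc-path e j = m+n<ᵇm n (j + e * suc p)

  edgeOf-path : ∀ e {j} → j < suc p → edgeOf (pathVertex e j) ≡ e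
  edgeOf-path e {j} j<q = trans (cong (_/ suc p) (m+n∸m≡n n (j + e * suc p))) ([r+b*d]/d≡b e j<q)

  posOf-path : ∀ e {j} → j < suc p → posOf (pathVertex e j) ≡ j
  posOf-path e {j} j<q = trans (cong (_% suc p) (m+n∸m≡n n (j + e * suc p))) ([r+b*d]%d≡r e j<q)

  nxt-suc : ∀ {a} → suc a < n → nxt a ≡ suc a
  nxt-suc {a} sa<n with suc a ≡ᵇ n in eq
  ... | false = refl
  ... | true  = contradiction (≡ᵇ⇒≡ (suc a) n (subst T (sym eq) _)) (<⇒≢ sa<n)

  nxt-last : ∀ {a} → suc a ≡ n → nxt a ≡ 0
  nxt-last {a} refl rewrite T⇒≡true (≡ᵇ-refl (suc a)) = refl

  nxt<n : ∀ {a} → a < n → nxt a < n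
  nxt<n {a} a<n with suc a <? n
  ... | yes sa<n = subst (_< n) (sym (nxt-suc sa<n)) sa<n
  ... | no  sa≮n = subst (_< n) (sym (nxt-last (≤-antisym a<n (≮⇒≥ sa≮n)))) (≤-<-trans z≤n a<n)

  adjℕ-sym : ∀ u v → adjℕ u v ≡ adjℕ v u
  adjℕ-sym u v with isCyc u | isCyc v
  ... | true  | true  = ∨-comm (nxt u ≡ᵇ v) (nxt v ≡ᵇ u)
  ... | true  | false = refl
  ... | false | true  = refl
  ... | false | false = cong₂ _∧_ (≡ᵇ-comm (edgeOf u) (edgeOf v))
                                  (∨-comm (suc (posOf u) ≡ᵇ posOf v) (suc (posOf v) ≡ᵇ posOf u))

  _~_ : ℕ → ℕ → Set
  u ~ v = T (adjℕ u v)

  ~-sym : ∀ {u v} → u ~ v → v ~ u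
  ~-sym {u} {v} = subst T (adjℕ-sym u v)

  cycle~nxt : ∀ {a} → a < n → a ~ nxt a
  cycle~nxt {a} a<n rewrite isCyc-cycle a<n | isCyc-cycle (nxt<n a<n) =
    Equivalence.from T-∨ (inj₁ (≡ᵇ-refl (nxt a)))

  cycle~first : ∀ {a} → a < n → a ~ pathVertex a 0
  cycle~first {a} a<n rewrite isCyc-cycle a<n | isCyc-path a 0 | posOf-path a z<s | edgeOf-path a z<s =
    Equivalence.from T-∨ (inj₁ (≡ᵇ-refl a))

  nxt~last : ∀ {e} → e < n → nxt e ~ pathVertex e p
  nxt~last {e} e<n rewrite isCyc-cycle (nxt<n e<n) | isCyc-path e p | posOf-path e ≤-refl | edgeOf-path e ≤-refl =
    Equivalence.from T-∨ (inj₂ (Equivalence.from T-∧ (≡ᵇ-refl p , ≡ᵇ-refl (nxt e))))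

  path~suc : ∀ e {j} → suc j < suc p → pathVertex e j ~ pathVertex e (suc j)
  path~suc e {j} sj<q rewrite isCyc-path e j | isCyc-path e (suc j)
    | posOf-path e (<-trans (n<1+n j) sj<q) | posOf-path e sj<q
    | edgeOf-path e (<-trans (n<1+n j) sj<q) | edgeOf-path e sj<q =
    Equivalence.from T-∧ (≡ᵇ-refl e , Equivalence.from T-∨ (inj₁ (≡ᵇ-refl (suc j))))

  zero~pred : .{{_ : NonZero n}} → 0 ~ pred n
  zero~pred = ~-sym (subst (pred n ~_) (nxt-last (suc-pred n)) (cycle~nxt pred[n]<n))

  suc~last : ∀ {a} → suc a < n → suc a ~ pathVertex a p
  suc~last {a} sa<n = subst (_~ pathVertex a p) (nxt-suc sa<n) (nxt~last (<-trans (n<1+n a) sa<n))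

  module VertexLabels (onCycle : ℕ → ℕ) (onPath : ℕ → ℕ → ℕ) where

    lab : ℕ → ℕ
    lab m = if isCyc m then onCycle m else onPath (edgeOf m) (posOf m)

    lab-cycle : ∀ {a} → a < n → lab a ≡ onCycle a
    lab-cycle a<n rewrite isCyc-cycle a<n = refl

    lab-path : ∀ e {j} → j < suc p → lab (pathVertex e j) ≡ onPath e j
    lab-path e {j} j<q rewrite isCyc-path e j | edgeOf-path e j<q | posOf-path e j<q = refl

  -- Labels are counted from 0 here: the vertex m receives the label suc (lab m).
  module _ (lab : ℕ → ℕ) where

    record CoprimeNeighbors (m : ℕ) : Set where
      constructor coprimeNeighbors
      field
        {u w x y} : ℕ
        u<order   : u < order
        w<order   : w < order
        m~u       : m ~ u
        m~w       : m ~ w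
        lab-u     : lab u ≡ x
        lab-w     : lab w ≡ y
        coprime   : Coprime (suc x) (suc y)

    coprime-nxt : ∀ {e x} → e < n → lab 0 ≡ 0 → (suc e < n → lab (suc e) ≡ suc x) →
                  Coprime (suc x) (suc (lab (nxt e)))
    coprime-nxt {e} {x} e<n lab0≡0 lab-suc with suc e <? n
    ... | yes se<n rewrite nxt-suc se<n | lab-suc se<n = coprime-suc (suc x)
    ... | no  se≮n rewrite nxt-last (≤-antisym e<n (≮⇒≥ se≮n)) | lab0≡0 =
      coprime-sym (1-coprimeTo (suc x))

  coprimeNeighbors⇒neighborhoodPrime :
    ∀ {lab vertexAt} → LeftInverseBelow order vertexAt lab → LeftInverseBelow order lab vertexAt →
    (∀ {a} → a < n → CoprimeNeighbors lab a) →
    (∀ {e j} → e < n → j < suc p → CoprimeNeighbors lab (pathVertex e j)) →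
    NeighborhoodPrime (starGon (3 + p) n)
  coprimeNeighbors⇒neighborhoodPrime {lab} vertexAt∘lab lab∘vertexAt cycleNeighbors pathNeighbors =
    π , λ v _ → nbhdGcdOne v
    where
      π : Fin order ⤖ Fin order
      π = permutationBelow vertexAt∘lab lab∘vertexAt

      neighbors : ∀ {m} → m < order → CoprimeNeighbors lab m
      neighbors m<order with vertexView m<order
      ... | cycle a<n    = cycleNeighbors a<n
      ... | path e<n j<q = pathNeighbors e<n j<q

      adj-fromℕ< : ∀ v {u} (u<order : u < order) → toℕ v ~ u →
                   T (adj (starGon (3 + p) n) v (fromℕ< u<order))
      adj-fromℕ< v u<order = subst (toℕ v ~_) (sym (toℕ-fromℕ< u<order))

      label-fromℕ< : ∀ {u} (u<order : u < order) → label π (fromℕ< u<order) ≡ suc (lab u)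
      label-fromℕ< u<order =
        cong suc (trans (toℕ-permutationBelow vertexAt∘lab lab∘vertexAt _) (cong lab (toℕ-fromℕ< u<order)))

      nbhdGcdOne : ∀ v → NbhdGcdOne (starGon (3 + p) n) π v
      nbhdGcdOne v with neighbors (toℕ<n v)
      ... | coprimeNeighbors u<order w<order v~u v~w refl refl coprime =
        coprimeNeighbors⇒NbhdGcdOne (starGon (3 + p) n) π v (adj-fromℕ< v u<order v~u) (adj-fromℕ< v w<order v~w)
          (subst₂ Coprime (sym (label-fromℕ< u<order)) (sym (label-fromℕ< w<order)) coprime)

module StarGon₃ (n : ℕ) .{{_ : NonZero n}} where
  open StarGeometry 0 n

  cycleNeighbors : ∀ {a} → a < n → CoprimeNeighbors id a
  cycleNeighbors {zero} 0<n =
    coprimeNeighbors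
      (cycle<order pred[n]<n) (path<order 0<n z<s)
      zero~pred (cycle~first 0<n)
      refl (trans (+-identityʳ n) (sym (suc-pred n)))
      (coprime-suc (suc (pred n)))
  cycleNeighbors {suc a} sa<n =
    coprimeNeighbors
      (path<order (<-trans (n<1+n a) sa<n) z<s) (path<order sa<n z<s)
      (suc~last sa<n) (cycle~first sa<n)
      refl (+-suc n (a * 1))
      (coprime-suc (suc (n + a * 1)))

  pathNeighbors : ∀ {e j} → e < n → j < 1 → CoprimeNeighbors id (pathVertex e j)
  pathNeighbors e<n (s≤s z≤n) =
    coprimeNeighbors
      (cycle<order e<n) (cycle<order (nxt<n e<n))
      (~-sym (cycle~first e<n)) (~-sym (nxt~last e<n))
      refl refl
      (coprime-nxt id e<n refl (λ _ → refl))

  neighborhoodPrime : NeighborhoodPrime (starGon 3 n)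
  neighborhoodPrime =
    coprimeNeighbors⇒neighborhoodPrime {id} {id} (λ m<order → m<order , refl) (λ m<order → m<order , refl)
      cycleNeighbors pathNeighbors

module StarGon₄ (n : ℕ) .{{_ : NonZero n}} where
  open StarGeometry 1 n

  code : ℕ → ℕ → ℕ
  code r e = r + e * 3

  open VertexLabels (code 0) (λ e j → code (2 ∸ j) e)

  cell : ℕ → ℕ → ℕ
  cell 0         e = e
  cell r@(suc _) e = pathVertex e (2 ∸ r)

  vertexAt : ℕ → ℕ
  vertexAt x = cell (x % 3) (x / 3)

  vertexAt-code : ∀ {r} e → r < 3 → vertexAt (code r e) ≡ cell r e
  vertexAt-code e r<3 = cong₂ cell ([r+b*d]%d≡r e r<3) ([r+b*d]/d≡b e r<3)

  code<order : ∀ {r e} → r < 3 → e < n → code r e < order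
  code<order {r} {e} r<3 e<n = subst (code r e <_) (sym order≡n*[2+p]) (r+b*d<B*d r<3 e<n)

  vertexAt∘lab : LeftInverseBelow order vertexAt lab
  vertexAt∘lab m<order with vertexView m<order
  ... | cycle {a} a<n rewrite lab-cycle a<n = code<order z<s a<n , vertexAt-code a z<s
  ... | path {e} e<n (s≤s z≤n) rewrite lab-path e z<s = code<order ≤-refl e<n , vertexAt-code e ≤-refl
  ... | path {e} e<n (s≤s (s≤s z≤n)) rewrite lab-path e ≤-refl =
    code<order 1<3 e<n , vertexAt-code e 1<3

  lab∘vertexAt : LeftInverseBelow order lab vertexAt
  lab∘vertexAt {x} x<order with quotRemView {3} {n} (subst (x <_) order≡n*[2+p] x<order)
  ... | quotRem {0} {e} r<3 e<n rewrite vertexAt-code e r<3 = cycle<order e<n , lab-cycle e<n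
  ... | quotRem {1} {e} r<3 e<n rewrite vertexAt-code e r<3 = path<order e<n ≤-refl , lab-path e ≤-refl
  ... | quotRem {2} {e} r<3 e<n rewrite vertexAt-code e r<3 = path<order e<n z<s , lab-path e z<s
  ... | quotRem {suc (suc (suc _))} (s≤s (s≤s (s≤s ()))) _

  lab0≡0 : lab 0 ≡ 0
  lab0≡0 = lab-cycle (>-nonZero⁻¹ n)

  cycleNeighbors : ∀ {a} → a < n → CoprimeNeighbors lab a
  cycleNeighbors {a} a<n =
    coprimeNeighbors
      (path<order a<n z<s) (cycle<order (nxt<n a<n))
      (cycle~first a<n) (cycle~nxt a<n)
      (lab-path a z<s) refl
      (coprime-nxt lab a<n lab0≡0 lab-cycle)

  pathNeighbors : ∀ {e j} → e < n → j < 2 → CoprimeNeighbors lab (pathVertex e j)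
  pathNeighbors {e} e<n (s≤s z≤n) =
    coprimeNeighbors
      (cycle<order e<n) (path<order e<n ≤-refl)
      (~-sym (cycle~first e<n)) (path~suc e ≤-refl)
      (lab-cycle e<n) (lab-path e ≤-refl)
      (coprime-suc (code 1 e))
  pathNeighbors {e} e<n (s≤s (s≤s z≤n)) =
    coprimeNeighbors
      (path<order e<n z<s) (cycle<order (nxt<n e<n))
      (~-sym (path~suc e ≤-refl)) (~-sym (nxt~last e<n))
      (lab-path e z<s) refl
      (coprime-nxt lab e<n lab0≡0 lab-cycle)

  neighborhoodPrime : NeighborhoodPrime (starGon 4 n)
  neighborhoodPrime = coprimeNeighbors⇒neighborhoodPrime vertexAt∘lab lab∘vertexAt cycleNeighbors pathNeighbors

module StarGon₅ (n : ℕ) .{{_ : NonZero n}} where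
  open StarGeometry 2 n

  code : ℕ → ℕ → ℕ → ℕ
  code r e h = r + (e + h * n) * 2

  pathLabel : ℕ → ℕ → ℕ
  pathLabel e 0 = code 0 e 1
  pathLabel e 1 = code 1 e 0
  pathLabel e _ = code 1 e 1

  open VertexLabels (λ a → code 0 a 0) pathLabel

  cell : ℕ → ℕ → ℕ → ℕ
  cell 0       e 0       = e
  cell 0       e (suc _) = pathVertex e 0
  cell (suc _) e 0       = pathVertex e 1
  cell (suc _) e (suc _) = pathVertex e 2

  vertexAt : ℕ → ℕ
  vertexAt x = cell (x % 2) (x / 2 % n) (x / 2 / n)

  vertexAt-code : ∀ {r e} h → r < 2 → e < n → vertexAt (code r e h) ≡ cell r e h
  vertexAt-code {r} {e} h r<2 e<n = begin
    vertexAt (code r e h)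
      ≡⟨ cong₂ (λ r b → cell r (b % n) (b / n))
               ([r+b*d]%d≡r (e + h * n) r<2) ([r+b*d]/d≡b (e + h * n) r<2) ⟩
    cell r ((e + h * n) % n) ((e + h * n) / n)
      ≡⟨ cong₂ (cell r) ([r+b*d]%d≡r h e<n) ([r+b*d]/d≡b h e<n) ⟩
    cell r e h
      ∎
    where open ≡-Reasoning

  order≡[2*n]*2 : order ≡ 2 * n * 2
  order≡[2*n]*2 = identity n
    where
      identity : ∀ n → n + n * 3 ≡ 2 * n * 2
      identity = solve-∀

  code<order : ∀ {r e h} → r < 2 → e < n → h < 2 → code r e h < order
  code<order {r} {e} {h} r<2 e<n h<2 =
    subst (code r e h <_) (sym order≡[2*n]*2) (r+b*d<B*d r<2 (r+b*d<B*d e<n h<2))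

  data Code : ℕ → Set where
    digits : ∀ {r e h} → r < 2 → e < n → h < 2 → Code (code r e h)

  codeView : ∀ {x} → x < order → Code x
  codeView {x} x<order with quotRemView {2} {2 * n} (subst (x <_) order≡[2*n]*2 x<order)
  ... | quotRem r<2 b<2n with quotRemView {n} {2} b<2n
  ...   | quotRem e<n h<2 = digits r<2 e<n h<2

  vertexAt∘lab : LeftInverseBelow order vertexAt lab
  vertexAt∘lab m<order with vertexView m<order
  ... | cycle {a} a<n rewrite lab-cycle a<n = code<order z<s a<n z<s , vertexAt-code 0 z<s a<n
  ... | path {e} e<n (s≤s z≤n) rewrite lab-path e z<s = code<order z<s e<n ≤-refl , vertexAt-code 1 z<s e<n
  ... | path {e} e<n (s≤s (s≤s z≤n)) rewrite lab-path e 1<3 =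
    code<order ≤-refl e<n z<s , vertexAt-code 0 ≤-refl e<n
  ... | path {e} e<n (s≤s (s≤s (s≤s z≤n))) rewrite lab-path e ≤-refl =
    code<order ≤-refl e<n ≤-refl , vertexAt-code 1 ≤-refl e<n

  lab∘vertexAt : LeftInverseBelow order lab vertexAt
  lab∘vertexAt x<order with codeView x<order
  ... | digits {0} {e} {0} r<2 e<n _ rewrite vertexAt-code 0 r<2 e<n = cycle<order e<n , lab-cycle e<n
  ... | digits {0} {e} {1} r<2 e<n _ rewrite vertexAt-code 1 r<2 e<n = path<order e<n z<s , lab-path e z<s
  ... | digits {1} {e} {0} r<2 e<n _ rewrite vertexAt-code 0 r<2 e<n =
    path<order e<n 1<3 , lab-path e 1<3
  ... | digits {1} {e} {1} r<2 e<n _ rewrite vertexAt-code 1 r<2 e<n = path<order e<n ≤-refl , lab-path e ≤-refl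
  ... | digits {suc (suc _)} (s≤s (s≤s ())) _ _
  ... | digits {_} {_} {suc (suc _)} _ _ (s≤s (s≤s ()))

  lab0≡0 : lab 0 ≡ 0
  lab0≡0 = lab-cycle (>-nonZero⁻¹ n)

  cycleNeighbors : ∀ {a} → a < n → CoprimeNeighbors lab a
  cycleNeighbors {zero} 0<n =
    coprimeNeighbors
      (cycle<order pred[n]<n) (path<order 0<n z<s)
      zero~pred (cycle~first 0<n)
      (trans (lab-cycle pred[n]<n) (cong (_* 2) (+-identityʳ (pred n))))
      (trans (lab-path 0 z<s) (cong (_* 2) (trans (+-identityʳ n) (sym (suc-pred n)))))
      (odd-coprime-odd+2 (pred n))
  cycleNeighbors {suc a} sa<n =
    coprimeNeighbors
      (path<order (<-trans (n<1+n a) sa<n) ≤-refl) (path<order sa<n z<s)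
      (suc~last sa<n) (cycle~first sa<n)
      (lab-path a ≤-refl) (lab-path (suc a) z<s)
      (coprime-suc (code 2 a 1))

  pathNeighbors : ∀ {e j} → e < n → j < 3 → CoprimeNeighbors lab (pathVertex e j)
  pathNeighbors {e} e<n (s≤s z≤n) =
    coprimeNeighbors
      (cycle<order e<n) (path<order e<n 1<3)
      (~-sym (cycle~first e<n)) (path~suc e 1<3)
      (lab-cycle e<n) (lab-path e 1<3)
      (coprime-suc (code 1 e 0))
  pathNeighbors {e} e<n (s≤s (s≤s z≤n)) =
    coprimeNeighbors
      (path<order e<n z<s) (path<order e<n ≤-refl)
      (~-sym (path~suc e 1<3)) (path~suc e ≤-refl)
      (lab-path e z<s) (lab-path e ≤-refl)
      (coprime-suc (code 1 e 1))
  pathNeighbors {e} e<n (s≤s (s≤s (s≤s z≤n))) =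
    coprimeNeighbors
      (path<order e<n 1<3) (cycle<order (nxt<n e<n))
      (~-sym (path~suc e ≤-refl)) (~-sym (nxt~last e<n))
      (lab-path e 1<3) refl
      (coprime-nxt lab e<n lab0≡0 lab-cycle)

  neighborhoodPrime : NeighborhoodPrime (starGon 5 n)
  neighborhoodPrime = coprimeNeighbors⇒neighborhoodPrime vertexAt∘lab lab∘vertexAt cycleNeighbors pathNeighbors

mainTheorem6 : (n k : ℕ) → n ≥ 3 → (k ≡ 3 ⊎ k ≡ 4 ⊎ k ≡ 5) →
    NeighborhoodPrime (starGon k n)
mainTheorem6 (suc n) _ _ (inj₁ refl)        = StarGon₃.neighborhoodPrime (suc n)
mainTheorem6 (suc n) _ _ (inj₂ (inj₁ refl)) = StarGon₄.neighborhoodPrime (suc n)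
mainTheorem6 (suc n) _ _ (inj₂ (inj₂ refl)) = StarGon₅.neighborhoodPrime (suc n)
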